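{- Let $G=(V,E)$ be a finite, connected, undirected graph (multiple edges allowed) with at least one edge, and let $p,q\ge 1$. Then $\theta(G)\le\frac{p}{q}$ if and only if $$\min_{J\subseteq E}\Big(\frac{p}{q}|J|+f(E\setminus J)\Big)\ge |V|-1.$$
   Context: $\Gamma$ denotes the set of spanning trees of $G$, each viewed as a set of edges. For $J\subseteq E$, $\mathcal{M}(J)=\min_{\gamma\in\Gamma}|\gamma\cap J|$, $\theta(J)=\mathcal{M}(J)/|J|$ if $J\neq\emptyset$, $\theta(\emptyset)=0$, and $\theta(G)=\max_{J\subseteq E}\theta(J)$. The graphic rank function is $f(J)=|V|-Q(G_J)$, where $G_J=(V,J)$ and $Q(G_J)$ is its number of connected components. -}

module Defs where

open import Data.Nat using (ℕ; _≤_; _*_; _+_; _∸_)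
open import Data.Fin using (Fin)
open import Data.Fin.Subset using (Subset; _∈_; _∩_; ∁; ∣_∣; _-_; ⊤)
open import Data.Product using (_×_; Σ; ∃; proj₁; proj₂; _,_)
open import Data.Sum using (_⊎_)
open import Function.Bundles using (_⇔_)
open import Relation.Binary.PropositionalEquality using (_≡_)
open import Function using (Surjective)
open import Relation.Nullary using (¬_)

-- A finite undirected multigraph: vertices Fin n, edges Fin m,
-- each edge has an (unordered) pair of endpoints.
record Graph : Set where
  field
    n : ℕ
    m : ℕ
    ends : Fin m → Fin n × Fin n

module _ (G : Graph) where
  open Graph G

  Joins : Fin m → Fin n → Fin n → Set
  Joins e u v = (ends e ≡ (u , v)) ⊎ (ends e ≡ (v , u))

  data Reach (J : Subset m) : Fin n → Fin n → Set where
    here : ∀ {u} → Reach J u u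
    step : ∀ {u w v} (e : Fin m) → e ∈ J → Joins e u w → Reach J w v → Reach J u v

  Connected : Set
  Connected = ∀ u v → Reach ⊤ u v

  -- G_J has exactly k connected components: there is a surjective labelling
  -- of the vertices by Fin k identifying exactly the connected vertices.
  NumComponents : Subset m → ℕ → Set
  NumComponents J k =
    Σ (Fin n → Fin k) λ c → Surjective _≡_ _≡_ c × (∀ u v → (c u ≡ c v) ⇔ Reach J u v)

  -- graphic rank function: f(J) = |V| - Q(G_J)  (as a relation: f(J) = r)
  Rank : Subset m → ℕ → Set
  Rank J r = Σ ℕ λ k → NumComponents J k × r ≡ n ∸ k

  -- γ is a spanning tree: (V, γ) is connected and acyclic; acyclic is expressed
  -- as: every edge of γ is a bridge of (V, γ), i.e. its endpoints become
  -- disconnected after removing it (so in particular loops never occur).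
  SpanningTree : Subset m → Set
  SpanningTree γ =
    (∀ u v → Reach γ u v) ×
    (∀ e → e ∈ γ → ¬ (Reach (γ - e) (proj₁ (ends e)) (proj₂ (ends e))))

  IsMinTreeIntersection : Subset m → ℕ → Set
  IsMinTreeIntersection J k =
    (Σ (Subset m) λ γ → SpanningTree γ × ∣ γ ∩ J ∣ ≡ k) ×
    (∀ γ → SpanningTree γ → k ≤ ∣ γ ∩ J ∣)

  -- θ(G) ≤ p/q : for every J ⊆ E, θ(J) ≤ p/q.  θ(∅) = 0 ≤ p/q trivially;
  -- for J ≠ ∅, θ(J) = 𝓜(J)/|J| ≤ p/q  ⇔  q·𝓜(J) ≤ p·|J|.
  ThetaLe : ℕ → ℕ → Set
  ThetaLe p q = ∀ (J : Subset m) → 1 ≤ ∣ J ∣ →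
    ∀ k → IsMinTreeIntersection J k → q * k ≤ p * ∣ J ∣

  -- min_{J ⊆ E} ( (p/q)|J| + f(E∖J) ) ≥ |V| - 1, multiplied through by q > 0
  MinCondition : ℕ → ℕ → Set
  MinCondition p q = ∀ (J : Subset m) → ∀ r → Rank (∁ J) r →
    q * (n ∸ 1) ≤ p * ∣ J ∣ + q * r

-- A spanning tree meets E ∖ J in a forest, hence in at most f(E ∖ J) edges, and
-- extending a maximal forest of E ∖ J to a spanning tree attains this bound; so
-- 𝓜(J) = (|V| - 1) - f(E ∖ J), and q·𝓜(J) ≤ p·|J| becomes q(|V| - 1) ≤ p|J| + q f(E ∖ J).
-- Both halves rest on the rank count of a forest, #components + #edges = |V|, and on
-- growing forests greedily: an edge between two components merges them, any other
-- edge is redundant.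
module Submission where

open import Defs
open import Data.Fin using (Fin; zero; suc; punchOut; punchIn)
open import Data.Fin.Properties
  using (punchOut-injective; punchOut-cong; punchOut-punchIn; punchInᵢ≢i; injective⇒≤)
  renaming (_≟_ to _≟ᶠ_)
open import Data.Fin.Subset
open import Data.Fin.Subset.Properties
open import Data.List using (List; []; _∷_; allFin)
open import Data.List.Membership.Propositional using () renaming (_∈_ to _∈ˡ_)
open import Data.List.Membership.Propositional.Properties using (∈-allFin)
open import Data.List.Relation.Unary.Any using (here; there)
open import Data.Nat using (ℕ; zero; suc; _+_; _*_; _∸_; _≤_; z≤n; s≤s)
open import Data.Nat.Properties
open import Data.Product using (∃; _×_; _,_; proj₁; proj₂; uncurry)
open import Data.Sum using (inj₁; inj₂)
import Data.Vec.Base as Vec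
open import Function using (_∘_)
open import Function.Bundles using (_⇔_; mk⇔; Equivalence)
import Relation.Binary.Construct.On as On
open import Relation.Binary.PropositionalEquality
open import Relation.Binary.Structures using (IsEquivalence)
open import Relation.Nullary using (¬_; Dec; yes; no; contradiction)

m+n≡o⇒n≡o∸m : ∀ m {n o} → m + n ≡ o → n ≡ o ∸ m
m+n≡o⇒n≡o∸m m {n} refl = sym (m+n∸m≡n m n)

q*x≤y⇔q*[x+b]≤y+q*b : ∀ q x b y → q * x ≤ y ⇔ q * (x + b) ≤ y + q * b
q*x≤y⇔q*[x+b]≤y+q*b q x b y = mk⇔
  (λ qx≤y → subst (_≤ y + q * b) (sym (*-distribˡ-+ q x b)) (+-monoˡ-≤ (q * b) qx≤y))
  (λ le → +-cancelʳ-≤ (q * b) (q * x) y (subst (_≤ y + q * b) (*-distribˡ-+ q x b) le))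

-- The case a = 0 is the convention θ(∅) = 0.
*-≤-unless-zero : ∀ p q {a x} → x ≤ a → (1 ≤ a → q * x ≤ p * a) → q * x ≤ p * a
*-≤-unless-zero p q {zero}  z≤n _ = ≤-reflexive (trans (*-zeroʳ q) (sym (*-zeroʳ p)))
*-≤-unless-zero p q {suc a} _   h = h (s≤s z≤n)

∣p∪⁅x⁆∣≡1+∣p∣ : ∀ {k} (p : Subset k) {x} → x ∉ p → ∣ p ∪ ⁅ x ⁆ ∣ ≡ suc ∣ p ∣
∣p∪⁅x⁆∣≡1+∣p∣ (inside  Vec.∷ p) {zero}  x∉p = contradiction Vec.here x∉p
∣p∪⁅x⁆∣≡1+∣p∣ (outside Vec.∷ p) {zero}  x∉p = cong (suc ∘ ∣_∣) (∪-identityʳ p)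
∣p∪⁅x⁆∣≡1+∣p∣ (inside  Vec.∷ p) {suc x} x∉p = cong suc (∣p∪⁅x⁆∣≡1+∣p∣ p (x∉p ∘ Vec.there))
∣p∪⁅x⁆∣≡1+∣p∣ (outside Vec.∷ p) {suc x} x∉p = ∣p∪⁅x⁆∣≡1+∣p∣ p (x∉p ∘ Vec.there)

∣p∣≡∣p∩q∣+∣p∩∁q∣ : ∀ {k} (p q : Subset k) → ∣ p ∣ ≡ ∣ p ∩ q ∣ + ∣ p ∩ ∁ q ∣
∣p∣≡∣p∩q∣+∣p∩∁q∣ Vec.[] Vec.[] = refl
∣p∣≡∣p∩q∣+∣p∩∁q∣ (inside  Vec.∷ p) (inside  Vec.∷ q) = cong suc (∣p∣≡∣p∩q∣+∣p∩∁q∣ p q)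
∣p∣≡∣p∩q∣+∣p∩∁q∣ (inside  Vec.∷ p) (outside Vec.∷ q) =
  trans (cong suc (∣p∣≡∣p∩q∣+∣p∩∁q∣ p q)) (sym (+-suc _ _))
∣p∣≡∣p∩q∣+∣p∩∁q∣ (outside Vec.∷ p) (inside  Vec.∷ q) = ∣p∣≡∣p∩q∣+∣p∩∁q∣ p q
∣p∣≡∣p∩q∣+∣p∩∁q∣ (outside Vec.∷ p) (outside Vec.∷ q) = ∣p∣≡∣p∩q∣+∣p∩∁q∣ p q

x∈p─q⇒x∉q : ∀ {k} {x : Fin k} (p q : Subset k) → x ∈ p ─ q → x ∉ q
x∈p─q⇒x∉q (_ Vec.∷ p) (inside Vec.∷ q) () Vec.here
x∈p─q⇒x∉q (_ Vec.∷ p) (_ Vec.∷ q) (Vec.there x∈p─q) (Vec.there x∈q) = x∈p─q⇒x∉q p q x∈p─q x∈q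

─-monoˡ-⊆ : ∀ {k} {p q : Subset k} (r : Subset k) → p ⊆ q → p ─ r ⊆ q ─ r
─-monoˡ-⊆ {p = p} r p⊆q x∈p─r = x∈p∧x∉q⇒x∈p─q (p⊆q (p─q⊆p p r x∈p─r)) (x∈p─q⇒x∉q p r x∈p─r)

∪⁅x⁆-⊆ : ∀ {k} {p q : Subset k} {x} → p ⊆ q → x ∈ q → p ∪ ⁅ x ⁆ ⊆ q
∪⁅x⁆-⊆ {p = p} {x = x} p⊆q x∈q y∈p∪⁅x⁆ with x∈p∪q⁻ p ⁅ x ⁆ y∈p∪⁅x⁆
... | inj₁ y∈p   = p⊆q y∈p
... | inj₂ y∈⁅x⁆ rewrite x∈⁅y⁆⇒x≡y x y∈⁅x⁆ = x∈q

module _ {k} {α β : Fin (suc k)} (α≢β : α ≢ β) where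

  redirect : Fin (suc k) → Fin (suc k)
  redirect x with x ≟ᶠ β
  ... | yes _ = α
  ... | no  _ = x

  β≢redirect : ∀ x → β ≢ redirect x
  β≢redirect x with x ≟ᶠ β
  ... | yes _   = α≢β ∘ sym
  ... | no  x≢β = x≢β ∘ sym

  redirect-β : redirect β ≡ α
  redirect-β with β ≟ᶠ β
  ... | yes _   = refl
  ... | no  β≢β = contradiction refl β≢β

  redirect-≢β : ∀ {x} → x ≢ β → redirect x ≡ x
  redirect-≢β {x} x≢β with x ≟ᶠ β
  ... | yes x≡β = contradiction x≡β x≢β
  ... | no  _   = refl

  -- Identifies the labels α and β and renumbers the rest into Fin k.
  collapse : Fin (suc k) → Fin k
  collapse x = punchOut (β≢redirect x)

  collapse-injective : ∀ {x y} → collapse x ≡ collapse y → redirect x ≡ redirect y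
  collapse-injective {x} {y} = punchOut-injective (β≢redirect x) (β≢redirect y)

  collapse-cong : ∀ {x y} → redirect x ≡ redirect y → collapse x ≡ collapse y
  collapse-cong = punchOut-cong β

  collapse-α≡collapse-β : collapse α ≡ collapse β
  collapse-α≡collapse-β = collapse-cong {α} {β} (trans (redirect-≢β α≢β) (sym redirect-β))

  collapse-punchIn : ∀ y → collapse (punchIn β y) ≡ y
  collapse-punchIn y =
    trans (punchOut-cong β (redirect-≢β (punchInᵢ≢i β y))) (punchOut-punchIn β)

module _ (G : Graph) where
  open Graph G

  src tgt : Fin m → Fin n
  src e = proj₁ (ends e)
  tgt e = proj₂ (ends e)

  private variable
    S T K : Subset m
    k k′ : ℕ
    u v w : Fin n

  edge-reach : ∀ {e} → e ∈ S → Reach G S (src e) (tgt e)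
  edge-reach e∈S = step _ e∈S (inj₁ refl) here

  Reach-trans : Reach G S u v → Reach G S v w → Reach G S u w
  Reach-trans here           r′ = r′
  Reach-trans (step e e∈S j r) r′ = step e e∈S j (Reach-trans r r′)

  Reach-sym : Reach G S u v → Reach G S v u
  Reach-sym here = here
  Reach-sym (step e e∈S (inj₁ j) r) = Reach-trans (Reach-sym r) (step e e∈S (inj₂ j) here)
  Reach-sym (step e e∈S (inj₂ j) r) = Reach-trans (Reach-sym r) (step e e∈S (inj₁ j) here)

  Reach-isEquivalence : IsEquivalence (Reach G S)
  Reach-isEquivalence = record { refl = here ; sym = Reach-sym ; trans = Reach-trans }

  Reach-least : ∀ {ℓ} {P : Fin n → Fin n → Set ℓ} → IsEquivalence P →
                (∀ {e} → e ∈ S → P (src e) (tgt e)) → Reach G S u v → P u v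
  Reach-least isEq edge here = IsEquivalence.refl isEq
  Reach-least {P = P} isEq edge (step e e∈S (inj₁ ends≡) r) =
    IsEquivalence.trans isEq (subst (uncurry P) ends≡ (edge e∈S)) (Reach-least isEq edge r)
  Reach-least {P = P} isEq edge (step e e∈S (inj₂ ends≡) r) =
    IsEquivalence.trans isEq (IsEquivalence.sym isEq (subst (uncurry P) ends≡ (edge e∈S)))
      (Reach-least isEq edge r)

  Reach-lift : (∀ {e} → e ∈ T → Reach G S (src e) (tgt e)) → Reach G T u v → Reach G S u v
  Reach-lift = Reach-least Reach-isEquivalence

  Reach-mono : S ⊆ T → Reach G S u v → Reach G T u v
  Reach-mono S⊆T = Reach-lift (edge-reach ∘ S⊆T)

  label : NumComponents G S k → Fin n → Fin k
  label = proj₁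

  representative : NumComponents G S k → Fin k → Fin n
  representative C i = proj₁ (proj₁ (proj₂ C) i)

  label-representative : (C : NumComponents G S k) (i : Fin k) → label C (representative C i) ≡ i
  label-representative C i = proj₂ (proj₁ (proj₂ C) i) refl

  label-≡⇒Reach : (C : NumComponents G S k) → label C u ≡ label C v → Reach G S u v
  label-≡⇒Reach C = Equivalence.to (proj₂ (proj₂ C) _ _)

  Reach⇒label-≡ : (C : NumComponents G S k) → Reach G S u v → label C u ≡ label C v
  Reach⇒label-≡ C = Equivalence.from (proj₂ (proj₂ C) _ _)

  components-antitone : S ⊆ T → NumComponents G S k → NumComponents G T k′ → k′ ≤ k
  components-antitone S⊆T C D = injective⇒≤ {f = label C ∘ representative D} injective
    where
    injective : ∀ {i j} → label C (representative D i) ≡ label C (representative D j) → i ≡ j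
    injective {i} {j} eq = begin
      i                             ≡⟨ label-representative D i ⟨
      label D (representative D i) ≡⟨ Reach⇒label-≡ D (Reach-mono S⊆T (label-≡⇒Reach C eq)) ⟩
      label D (representative D j) ≡⟨ label-representative D j ⟩
      j                             ∎
      where open ≡-Reasoning

  components-unique : NumComponents G S k → NumComponents G S k′ → k ≡ k′
  components-unique C D = ≤-antisym (components-antitone ⊆-refl D C) (components-antitone ⊆-refl C D)

  components-transfer : S ⊆ T → (∀ {e} → e ∈ T → Reach G S (src e) (tgt e)) →
                        NumComponents G S k → NumComponents G T k
  components-transfer S⊆T spans (c , c-surjective , c-correct) = c , c-surjective , λ u v → mk⇔
    (Reach-mono S⊆T ∘ Equivalence.to (c-correct u v))
    (Equivalence.from (c-correct u v) ∘ Reach-lift spans)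

  components-⊥ : NumComponents G ⊥ n
  components-⊥ = (λ u → u) , (λ u → u , λ eq → eq) , λ u v → mk⇔ (λ { refl → here }) Reach⊥⇒≡
    where
    Reach⊥⇒≡ : Reach G ⊥ u v → u ≡ v
    Reach⊥⇒≡ here = refl
    Reach⊥⇒≡ (step e e∈⊥ _ _) = contradiction e∈⊥ ∉⊥

  components-merge : ∀ {e} (C : NumComponents G S k) → label C (src e) ≢ label C (tgt e) →
                     ∃ λ k′ → k ≡ suc k′ × NumComponents G (S ∪ ⁅ e ⁆) k′
  components-merge {k = zero} {e} C _ with label C (src e)
  ... | ()
  components-merge {S} {suc k} {e} C@(c , c-surjective , _) α≢β =
    k , refl , collapse α≢β ∘ c , surjective , λ u v → mk⇔ (complete u v) sound
    where
    S⊆S∪⁅e⁆ : S ⊆ S ∪ ⁅ e ⁆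
    S⊆S∪⁅e⁆ = p⊆p∪q ⁅ e ⁆

    e∈S∪⁅e⁆ : e ∈ S ∪ ⁅ e ⁆
    e∈S∪⁅e⁆ = q⊆p∪q S ⁅ e ⁆ (x∈⁅x⁆ e)

    surjective : ∀ i → ∃ λ u → ∀ {z} → z ≡ u → collapse α≢β (c z) ≡ i
    surjective i = representative C (punchIn (c (tgt e)) i) , λ { refl →
      trans (cong (collapse α≢β) (label-representative C _)) (collapse-punchIn α≢β i) }

    redirected : ∀ u → ∃ λ w → c w ≡ redirect α≢β (c u) × Reach G (S ∪ ⁅ e ⁆) u w
    redirected u = by-cases (c u ≟ᶠ c (tgt e))
      where
      by-cases : Dec (c u ≡ c (tgt e)) → ∃ λ w → c w ≡ redirect α≢β (c u) × Reach G (S ∪ ⁅ e ⁆) u w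
      by-cases (yes cu≡β) = src e , sym (trans (cong (redirect α≢β) cu≡β) (redirect-β α≢β)) ,
        Reach-trans (Reach-mono S⊆S∪⁅e⁆ (label-≡⇒Reach C cu≡β)) (Reach-sym (edge-reach e∈S∪⁅e⁆))
      by-cases (no cu≢β) = u , sym (redirect-≢β α≢β cu≢β) , here

    complete : ∀ u v → collapse α≢β (c u) ≡ collapse α≢β (c v) → Reach G (S ∪ ⁅ e ⁆) u v
    complete u v eq with redirected u | redirected v
    ... | wu , cwu≡ , u⇝wu | wv , cwv≡ , v⇝wv = Reach-trans u⇝wu (Reach-trans
      (Reach-mono S⊆S∪⁅e⁆ (label-≡⇒Reach C (trans cwu≡ (trans (collapse-injective α≢β {c u} {c v} eq) (sym cwv≡)))))
      (Reach-sym v⇝wv))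

    collapse-edge : ∀ {f} → f ∈ S ∪ ⁅ e ⁆ → collapse α≢β (c (src f)) ≡ collapse α≢β (c (tgt f))
    collapse-edge f∈S∪⁅e⁆ with x∈p∪q⁻ S ⁅ e ⁆ f∈S∪⁅e⁆
    ... | inj₁ f∈S  = cong (collapse α≢β) (Reach⇒label-≡ C (edge-reach f∈S))
    ... | inj₂ f∈⁅e⁆ rewrite x∈⁅y⁆⇒x≡y e f∈⁅e⁆ = collapse-α≡collapse-β α≢β

    sound : Reach G (S ∪ ⁅ e ⁆) u v → collapse α≢β (c u) ≡ collapse α≢β (c v)
    sound = Reach-least (On.isEquivalence (collapse α≢β ∘ c) isEquivalence) collapse-edge

  connected⇒one-component : Fin n → NumComponents G S k → (∀ u v → Reach G S u v) → k ≡ 1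
  connected⇒one-component {k = zero} v C _ with label C v
  ... | ()
  connected⇒one-component {k = suc zero} _ _ _ = refl
  connected⇒one-component {k = suc (suc k)} _ C connected
    with trans (sym (label-representative C zero))
          (trans (Reach⇒label-≡ C (connected _ _)) (label-representative C (suc zero)))
  ... | ()

  Forest : Subset m → Set
  Forest K = ∀ e → e ∈ K → ¬ Reach G (K - e) (src e) (tgt e)

  Forest-⊆ : S ⊆ K → Forest K → Forest S
  Forest-⊆ S⊆K forest e e∈S = forest e (S⊆K e∈S) ∘ Reach-mono (─-monoˡ-⊆ ⁅ e ⁆ S⊆K)

  -- count + |F| = n is the rank count of a forest (rank⇒forest); L lists the edges of K
  -- processed so far.
  record ForestExtension (F₀ K : Subset m) (L : List (Fin m)) : Set where
    field
      F          : Subset m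
      count      : ℕ
      F₀⊆F       : F₀ ⊆ F
      F⊆F₀∪K     : F ⊆ F₀ ∪ K
      components : NumComponents G F count
      rank       : count + ∣ F ∣ ≡ n
      spans      : ∀ {e} → e ∈ˡ L → e ∈ K → Reach G F (src e) (tgt e)

  private
    skip : ∀ {F₀ L e} (X : ForestExtension F₀ K L) →
           (e ∈ K → Reach G (ForestExtension.F X) (src e) (tgt e)) → ForestExtension F₀ K (e ∷ L)
    skip X spans-e = record
      { F = F ; count = count ; F₀⊆F = F₀⊆F ; F⊆F₀∪K = F⊆F₀∪K ; components = components ; rank = rank
      ; spans = λ { (here refl) → spans-e ; (there f∈L) → spans f∈L } }
      where open ForestExtension X

    add : ∀ {F₀ L e k′} (X : ForestExtension F₀ K L) → e ∈ K →
          let open ForestExtension X in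
          e ∉ F → count ≡ suc k′ → NumComponents G (F ∪ ⁅ e ⁆) k′ → ForestExtension F₀ K (e ∷ L)
    add {K} {F₀} {e = e} {k′} X e∈K e∉F count≡1+k′ C′ = record
      { F          = F ∪ ⁅ e ⁆
      ; count      = k′
      ; F₀⊆F       = p⊆p∪q ⁅ e ⁆ ∘ F₀⊆F
      ; F⊆F₀∪K     = ∪⁅x⁆-⊆ F⊆F₀∪K (q⊆p∪q F₀ K e∈K)
      ; components = C′
      ; rank       = begin
          k′ + ∣ F ∪ ⁅ e ⁆ ∣ ≡⟨ cong (k′ +_) (∣p∪⁅x⁆∣≡1+∣p∣ F e∉F) ⟩
          k′ + suc ∣ F ∣     ≡⟨ +-suc k′ ∣ F ∣ ⟩
          suc k′ + ∣ F ∣     ≡⟨ cong (_+ ∣ F ∣) count≡1+k′ ⟨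
          count + ∣ F ∣      ≡⟨ rank ⟩
          n                  ∎
      ; spans      = λ
          { (here refl) _ → edge-reach (q⊆p∪q F ⁅ e ⁆ (x∈⁅x⁆ e))
          ; (there f∈L) f∈K → Reach-mono (p⊆p∪q ⁅ e ⁆) (spans f∈L f∈K) }
      }
      where
      open ForestExtension X
      open ≡-Reasoning

    extend-by : ∀ {F₀ L} e → ForestExtension F₀ K L → ForestExtension F₀ K (e ∷ L)
    extend-by {K} {F₀} {L} e X = decide (e ∈? K) (label components (src e) ≟ᶠ label components (tgt e))
      where
      open ForestExtension X using (components)
      decide : Dec (e ∈ K) → Dec (label components (src e) ≡ label components (tgt e)) →
               ForestExtension F₀ K (e ∷ L)
      decide (no e∉K)  _           = skip X (λ e∈K → contradiction e∈K e∉K)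
      decide (yes _)   (yes same)  = skip X (λ _ → label-≡⇒Reach components same)
      decide (yes e∈K) (no differ) with components-merge components differ
      ... | k′ , count≡1+k′ , C′ =
        add X e∈K (differ ∘ Reach⇒label-≡ components ∘ edge-reach) count≡1+k′ C′

  greedy : ∀ {F₀} → NumComponents G F₀ k → k + ∣ F₀ ∣ ≡ n → ∀ L → ForestExtension F₀ K L
  greedy {k} {F₀ = F₀} C₀ rank₀ [] = record
    { F = F₀ ; count = k ; F₀⊆F = λ x → x ; F⊆F₀∪K = p⊆p∪q _ ; components = C₀ ; rank = rank₀
    ; spans = λ () }
  greedy C₀ rank₀ (e ∷ L) = extend-by e (greedy C₀ rank₀ L)

  spanningForest : ∀ K → ForestExtension ⊥ K (allFin m)
  spanningForest K = greedy components-⊥ (trans (cong (n +_) (∣⊥∣≡0 m)) (+-identityʳ n)) (allFin m)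

  spanningForest-⊆ : ForestExtension.F (spanningForest K) ⊆ K
  spanningForest-⊆ {K} =
    subst (ForestExtension.F (spanningForest K) ⊆_) (∪-identityˡ K) (ForestExtension.F⊆F₀∪K (spanningForest K))

  spanningForest-components : NumComponents G S (ForestExtension.count (spanningForest S))
  spanningForest-components {S} = components-transfer spanningForest-⊆ (spans (∈-allFin _)) components
    where open ForestExtension (spanningForest S)

  components-exist : ∀ S → ∃ (NumComponents G S)
  components-exist S = _ , spanningForest-components

  n≤components+size : NumComponents G S k → n ≤ k + ∣ S ∣
  n≤components+size {S} {k} C = begin
    n              ≡⟨ rank ⟨
    count + ∣ F ∣  ≡⟨ cong (_+ ∣ F ∣) (components-unique spanningForest-components C) ⟩
    k + ∣ F ∣      ≤⟨ +-monoʳ-≤ k (p⊆q⇒∣p∣≤∣q∣ spanningForest-⊆) ⟩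
    k + ∣ S ∣      ∎
    where
    open ForestExtension (spanningForest S)
    open ≤-Reasoning

  forest⇒rank : Forest S → NumComponents G S k → k + ∣ S ∣ ≡ n
  forest⇒rank {S} forest C = trans
    (cong₂ _+_ (components-unique C (subst (λ T → NumComponents G T count) F≡S components))
               (cong ∣_∣ (sym F≡S)))
    rank
    where
    open ForestExtension (spanningForest S)
    S⊆F : S ⊆ F
    S⊆F {e} e∈S with e ∈? F
    ... | yes e∈F = e∈F
    ... | no  e∉F = contradiction (Reach-mono F⊆S-e (spans (∈-allFin e) e∈S)) (forest e e∈S)
      where
      F⊆S-e : F ⊆ S - e
      F⊆S-e f∈F = x∈p∧x≢y⇒x∈p-y (spanningForest-⊆ f∈F) λ { refl → e∉F f∈F }
    F≡S : F ≡ S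
    F≡S = ⊆-antisym spanningForest-⊆ S⊆F

  rank⇒forest : NumComponents G S k → k + ∣ S ∣ ≡ n → Forest S
  rank⇒forest {S} {k} C rank e e∈S ends-reach = <-irrefl refl (begin-strict
    n               ≤⟨ n≤components+size C′ ⟩
    k-e + ∣ S - e ∣ ≡⟨ cong (_+ ∣ S - e ∣) (components-unique C″ C) ⟩
    k + ∣ S - e ∣   <⟨ +-monoʳ-< k (x∈p⇒∣p-x∣<∣p∣ e∈S) ⟩
    k + ∣ S ∣       ≡⟨ rank ⟩
    n               ∎)
    where
    open ≤-Reasoning
    k-e : ℕ
    k-e = proj₁ (components-exist (S - e))
    C′ : NumComponents G (S - e) k-e
    C′ = proj₂ (components-exist (S - e))
    spans : ∀ {f} → f ∈ S → Reach G (S - e) (src f) (tgt f)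
    spans {f} f∈S with f ≟ᶠ e
    ... | yes refl = ends-reach
    ... | no  f≢e  = edge-reach (x∈p∧x≢y⇒x∈p-y f∈S f≢e)
    C″ : NumComponents G S k-e
    C″ = components-transfer (p─q⊆p S ⁅ e ⁆) spans C′

  spanningTree-size : Fin n → ∀ {γ} → SpanningTree G γ → ∣ γ ∣ ≡ n ∸ 1
  spanningTree-size v {γ} (connected , forest) =
    m+n≡o⇒n≡o∸m 1 (subst (λ k → k + ∣ γ ∣ ≡ n) (connected⇒one-component v C connected) (forest⇒rank forest C))
    where
    C : NumComponents G γ (proj₁ (components-exist γ))
    C = proj₂ (components-exist γ)

  treeIntersection-lower : ∀ {J γ} → Fin n → NumComponents G (∁ J) k → SpanningTree G γ →
                           n ∸ 1 ≤ ∣ γ ∩ J ∣ + (n ∸ k)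
  treeIntersection-lower {k} {J} {γ} v C tree@(_ , forest) = begin
    n ∸ 1                   ≡⟨ spanningTree-size v tree ⟨
    ∣ γ ∣                   ≡⟨ ∣p∣≡∣p∩q∣+∣p∩∁q∣ γ J ⟩
    ∣ γ ∩ J ∣ + ∣ γ ∩ ∁ J ∣ ≡⟨ cong (∣ γ ∩ J ∣ +_) (m+n≡o⇒n≡o∸m k-out (forest⇒rank outside-J C′)) ⟩
    ∣ γ ∩ J ∣ + (n ∸ k-out) ≤⟨ +-monoʳ-≤ ∣ γ ∩ J ∣ (∸-monoʳ-≤ n (components-antitone (p∩q⊆q γ (∁ J)) C′ C)) ⟩
    ∣ γ ∩ J ∣ + (n ∸ k)     ∎
    where
    open ≤-Reasoning
    outside-J : Forest (γ ∩ ∁ J)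
    outside-J = Forest-⊆ (p∩q⊆p γ (∁ J)) forest
    k-out : ℕ
    k-out = proj₁ (components-exist (γ ∩ ∁ J))
    C′ : NumComponents G (γ ∩ ∁ J) k-out
    C′ = proj₂ (components-exist (γ ∩ ∁ J))

  -- Extend a maximal forest of E ∖ J to a spanning tree.
  treeIntersection-attained : ∀ {J} → Connected G → Fin n → NumComponents G (∁ J) k →
                              ∃ λ γ → SpanningTree G γ × ∣ γ ∩ J ∣ + (n ∸ k) ≤ n ∸ 1
  treeIntersection-attained {k} {J} connected v C = γ , tree , (begin
    ∣ γ ∩ J ∣ + (n ∸ k)      ≡⟨ cong (∣ γ ∩ J ∣ +_) (m+n≡o⇒n≡o∸m k rank₁) ⟨
    ∣ γ ∩ J ∣ + ∣ F₁ ∣       ≤⟨ +-monoʳ-≤ ∣ γ ∩ J ∣ (p⊆q⇒∣p∣≤∣q∣ (λ x∈F₁ → x∈p∩q⁺ (F₁⊆γ x∈F₁ , spanningForest-⊆ x∈F₁))) ⟩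
    ∣ γ ∩ J ∣ + ∣ γ ∩ ∁ J ∣  ≡⟨ ∣p∣≡∣p∩q∣+∣p∩∁q∣ γ J ⟨
    ∣ γ ∣                    ≡⟨ spanningTree-size v tree ⟩
    n ∸ 1                    ∎)
    where
    open ≤-Reasoning
    open ForestExtension (spanningForest (∁ J)) using ()
      renaming (F to F₁; count to k₁; components to C₁; rank to rank₁′)
    k₁≡k : k₁ ≡ k
    k₁≡k = components-unique spanningForest-components C
    rank₁ : k + ∣ F₁ ∣ ≡ n
    rank₁ = subst (λ k → k + ∣ F₁ ∣ ≡ n) k₁≡k rank₁′
    open ForestExtension (greedy {K = ⊤} C₁ rank₁′ (allFin m))
      renaming (F to γ; F₀⊆F to F₁⊆γ)
    tree : SpanningTree G γ
    tree = (λ u v → Reach-lift (λ _ → spans (∈-allFin _) ∈⊤) (connected u v))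
         , rank⇒forest components rank

  minTreeIntersection-exists : ∀ {J} → Connected G → Fin n → NumComponents G (∁ J) k →
                               ∃ (IsMinTreeIntersection G J)
  minTreeIntersection-exists {k} {J} connected v C =
    let γ , tree , attained = treeIntersection-attained connected v C in
    ∣ γ ∩ J ∣ , (γ , tree , refl) , λ γ′ tree′ →
      +-cancelʳ-≤ (n ∸ k) ∣ γ ∩ J ∣ ∣ γ′ ∩ J ∣ (≤-trans attained (treeIntersection-lower v C tree′))

  minTreeIntersection-≤ : ∀ {J x} → IsMinTreeIntersection G J x → x ≤ ∣ J ∣
  minTreeIntersection-≤ {J} ((γ , _ , refl) , _) = ∣p∩q∣≤∣q∣ γ J

  minTreeIntersection : ∀ {J x} → Connected G → Fin n → NumComponents G (∁ J) k →
                        IsMinTreeIntersection G J x → x + (n ∸ k) ≡ n ∸ 1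
  minTreeIntersection {k} connected v C ((γ₀ , tree₀ , γ₀∩J≡x) , minimal) =
    let γ , tree , attained = treeIntersection-attained connected v C in
    ≤-antisym
      (≤-trans (+-monoˡ-≤ (n ∸ k) (minimal γ tree)) attained)
      (subst (λ y → n ∸ 1 ≤ y + (n ∸ k)) γ₀∩J≡x (treeIntersection-lower v C tree₀))

lemma12 : (G : Graph) → Connected G → 1 ≤ Graph.m G →
    (p q : ℕ) → 1 ≤ p → 1 ≤ q →
    ThetaLe G p q ⇔ MinCondition G p q
lemma12 G connected m≥1 p q _ _ = mk⇔ to from
  where
  open Graph G

  vertex : Fin n
  vertex = src G (edge m≥1)
    where
    edge : ∀ {m} → 1 ≤ m → Fin m
    edge (s≤s _) = zero

  to : ThetaLe G p q → MinCondition G p q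
  to θ≤p/q J _ (k , C , refl) =
    let x , isMin = minTreeIntersection-exists G connected vertex C
        qx≤p∣J∣ = *-≤-unless-zero p q (minTreeIntersection-≤ G isMin) (λ J≢∅ → θ≤p/q J J≢∅ x isMin)
    in subst (λ z → q * z ≤ p * ∣ J ∣ + q * (n ∸ k)) (minTreeIntersection G connected vertex C isMin)
         (Equivalence.to (q*x≤y⇔q*[x+b]≤y+q*b q x (n ∸ k) (p * ∣ J ∣)) qx≤p∣J∣)

  from : MinCondition G p q → ThetaLe G p q
  from minCondition J _ x isMin =
    let k , C = components-exist G (∁ J)
    in Equivalence.from (q*x≤y⇔q*[x+b]≤y+q*b q x (n ∸ k) (p * ∣ J ∣))
         (subst (λ z → q * z ≤ p * ∣ J ∣ + q * (n ∸ k)) (sym (minTreeIntersection G connected vertex C isMin))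
           (minCondition J (n ∸ k) (k , C , refl)))
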